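{- $\mathcal{Z}_{q,1}=\left\langle \zeta_q^{\mathrm{BZ}}(k_1,\dots,k_r)\,\middle|\, r\ge0,\ k_1\ge2,\ k_2,\dots,k_r\ge1\right\rangle_{\mathbb{Q}}$.
   Context: $q$ is a formal variable. For $r\ge 0$, integers $k_1,\dots,k_r\ge 0$ and polynomials $Q_1\in X\mathbb{Q}[X]$, $Q_2,\dots,Q_r\in\mathbb{Q}[X]$ with $\deg(Q_j)\le k_j$, set $\zeta_q(k_1,\dots,k_r;Q_1,\dots,Q_r):=\sum_{m_1>\dots>m_r>0}\prod_{j=1}^r\frac{Q_j(q^{m_j})}{(1-q^{m_j})^{k_j}}\in\mathbb{Q}[[q]]$ (empty value $1$). $\mathcal{Z}_{q,1}$ is the $\mathbb{Q}$-span of all $\zeta_q(k_1,\dots,k_r;Q_1,\dots,Q_r)$ with $r\ge0$, $k_1,\dots,k_r\ge1$, $Q_1\in X\mathbb{Q}[X]$ and $\deg(Q_j)\le k_j-1$ for all $j$. For $k_1\ge2$, $k_2,\dots,k_r\ge1$, the Bradley--Zhao value is $\zeta_q^{\mathrm{BZ}}(k_1,\dots,k_r):=\zeta_q(k_1,\dots,k_r;X^{k_1-1},\dots,X^{k_r-1})=\sum_{m_1>\dots>m_r>0}\prod_{j=1}^r\frac{q^{m_j(k_j-1)}}{(1-q^{m_j})^{k_j}}$, with $\zeta_q^{\mathrm{BZ}}(\emptyset)=1$. -}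

module Defs where

open import Data.Nat using (ℕ; zero; suc; _∸_; _≤_; _≟_)
open import Data.Nat.DivMod using (_%_; _/_)
open import Data.Rational using (ℚ; 0ℚ; 1ℚ) renaming (_+_ to _+ℚ_; _*_ to _*ℚ_)
open import Data.List using (List; []; _∷_; length)
open import Data.List.Relation.Unary.All using (All)
open import Data.Product using (_×_; _,_; Σ; ∃)
open import Relation.Binary.PropositionalEquality using (_≡_)
open import Relation.Nullary using (yes; no)
open import Data.Unit using (⊤)

-- Formal power series in q over ℚ, represented by their coefficient
-- sequences:  f = Σ_n f n · q^n.  Equality of series is coefficientwise.

Series : Set
Series = ℕ → ℚ

_≋_ : Series → Series → Set
f ≋ g = ∀ n → f n ≡ g n

zeroS : Series
zeroS _ = 0ℚ

oneS : Series
oneS zero    = 1ℚ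
oneS (suc _) = 0ℚ

_⊕_ : Series → Series → Series
(f ⊕ g) n = f n +ℚ g n

scaleS : ℚ → Series → Series
scaleS c f n = c *ℚ f n

sumUpTo : (ℕ → ℚ) → ℕ → ℚ
sumUpTo h zero    = h zero
sumUpTo h (suc n) = sumUpTo h n +ℚ h (suc n)

_⊛_ : Series → Series → Series
(f ⊛ g) n = sumUpTo (λ i → f i *ℚ g (n ∸ i)) n

geomS : Series
geomS _ = 1ℚ

invPow : ℕ → Series
invPow zero    = oneS
invPow (suc k) = geomS ⊛ invPow k

-- Polynomials over ℚ as coefficient lists, constant term first:
-- [a₀, a₁, …, a_d] represents a₀ + a₁ X + … + a_d X^d.

Poly : Set
Poly = List ℚ

polyS : Poly → Series
polyS []       _       = 0ℚ
polyS (a ∷ _)  zero    = a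
polyS (_ ∷ as) (suc n) = polyS as n

constTerm : Poly → ℚ
constTerm []      = 0ℚ
constTerm (a ∷ _) = a

monomial : ℕ → Poly
monomial zero    = 1ℚ ∷ []
monomial (suc n) = 0ℚ ∷ monomial n

-- substitution x ↦ q^(suc m) in a power series in x
substPow : ℕ → Series → Series
substPow m f N with N % suc m ≟ 0
... | yes _ = f (N / suc m)
... | no  _ = 0ℚ

-- Q(q^m) / (1 - q^m)^k  for m = suc m'
termS : ℕ → Poly → ℕ → Series
termS k Q m' = substPow m' (polyS Q ⊛ invPow k)

sumBelow : (ℕ → Series) → ℕ → Series
sumBelow g zero    = zeroS
sumBelow g (suc n) = sumBelow g n ⊕ g n

-- truncated multiple sum over  M > m₁ > … > m_r > 0
truncZ : List (ℕ × Poly) → ℕ → Series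
truncZ []             M = oneS
truncZ ((k , Q) ∷ ks) M =
  sumBelow (λ i → termS k Q i ⊛ truncZ ks (suc i)) (M ∸ 1)

-- Its N-th coefficient is computed from the
-- finite sum over N+1 > m₁ > … > m_r > 0; when Q₁(0) = 0 the summand
-- indexed by (m₁,…) has q-order ≥ m₁, so this is exactly the N-th
-- coefficient of the full infinite sum.  (For r = 0 the value is 1.)
zetaQ : List (ℕ × Poly) → Series
zetaQ ks N = truncZ ks (suc N) N

-- Admissible data for the generators of 𝒵_{q,1}:
-- k_j ≥ 1, deg Q_j ≤ k_j - 1 (i.e. length of coefficient list ≤ k_j),
-- and Q₁ ∈ X ℚ[X] (constant term 0).

AdmEntry : ℕ × Poly → Set
AdmEntry (k , Q) = (1 ≤ k) × (length Q ≤ k)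

FirstNoConst : List (ℕ × Poly) → Set
FirstNoConst []             = ⊤
FirstNoConst ((k , Q) ∷ _)  = constTerm Q ≡ 0ℚ

AdmZ1 : List (ℕ × Poly) → Set
AdmZ1 ks = All AdmEntry ks × FirstNoConst ks

AdmBZ : List ℕ → Set
AdmBZ []       = ⊤
AdmBZ (k ∷ ks) = (2 ≤ k) × All (λ k' → 1 ≤ k') ks

bzData : List ℕ → List (ℕ × Poly)
bzData []       = []
bzData (k ∷ ks) = (k , monomial (k ∸ 1)) ∷ bzData ks

zetaBZ : List ℕ → Series
zetaBZ ks = zetaQ (bzData ks)

linComb : {I : Set} → (I → Series) → List (ℚ × I) → Series
linComb gen []             = zeroS
linComb gen ((c , i) ∷ cs) = scaleS c (gen i) ⊕ linComb gen cs

InSpan : {I : Set} → (I → Set) → (I → Series) → Series → Set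
InSpan {I} P gen f =
  Σ (List (ℚ × I)) λ cs → All (λ ci → P (Data.Product.proj₂ ci)) cs × (f ≋ linComb gen cs)

InZq1 : Series → Set
InZq1 = InSpan AdmZ1 zetaQ

InBZSpan : Series → Set
InBZSpan = InSpan AdmBZ zetaBZ

{-# OPTIONS --safe #-}
-- Iterating 1/(1-x)^(k+1) = 1/(1-x)^k + x/(1-x)^(k+1) writes every x^a/(1-x)^k with a < k,
-- hence every Q(x)/(1-x)^k with deg Q < k, as a ℚ-combination of the Bradley–Zhao kernels
-- x^(j-1)/(1-x)^j with 1 ≤ j ≤ k; when Q(0) = 0 only kernels with j ≥ 2 occur.  Substituting
-- x = q^m and expanding the nested sum multilinearly, with coefficients independent of the
-- summation indices, turns each generator of 𝒵_{q,1} into a combination of ζ_q^BZ values.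
-- Conversely Bradley–Zhao data are themselves admissible.
module Submission where

open import Defs
open import Algebra.Bundles using (CommutativeMonoid)
open import Data.List using (List; []; _∷_; _++_; map; concatMap; length)
open import Data.List.Relation.Unary.All as All using (All; []; _∷_)
open import Data.List.Relation.Unary.All.Properties using (++⁺; map⁺)
open import Data.Nat as ℕ using (ℕ; zero; suc; _∸_; _≤_; _<_; z≤n; s≤s)
open import Data.Nat.DivMod using (_%_; _/_)
open import Data.Nat.Properties using (+-suc; +-comm; ≤-refl; <⇒≤)
open import Data.Product using (Σ; _×_; _,_; proj₁; proj₂; uncurry; map₁; map₂)
open import Data.Rational using (ℚ; 0ℚ; 1ℚ; _+_; _*_)
import Data.Rational.Properties as ℚ
open import Data.Unit using (tt)
open import Function using (_∘_; id)
open import Relation.Binary.Bundles using (Setoid)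
open import Relation.Binary.PropositionalEquality using (_≡_; refl; sym; trans; cong; cong₂)
open import Relation.Nullary using (yes; no)
open import Algebra.Properties.CommutativeSemigroup
  (CommutativeMonoid.commutativeSemigroup ℚ.+-0-commutativeMonoid) using (interchange)

private variable
  A B C I J : Set

≋-setoid : Setoid _ _
≋-setoid = record
  { Carrier       = Series
  ; _≈_           = _≋_
  ; isEquivalence = record
    { refl  = λ _ → refl
    ; sym   = λ f≋g n → sym (f≋g n)
    ; trans = λ f≋g g≋h n → trans (f≋g n) (g≋h n)
    }
  }

open Setoid ≋-setoid using ()
  renaming (refl to ≋-refl; reflexive to ≋-reflexive; sym to ≋-sym; trans to ≋-trans)
open import Relation.Binary.Reasoning.Setoid ≋-setoid

⊕-cong : ∀ {f f' g g'} → f ≋ f' → g ≋ g' → (f ⊕ g) ≋ (f' ⊕ g')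
⊕-cong f≋f' g≋g' n = cong₂ _+_ (f≋f' n) (g≋g' n)

⊕-congˡ : ∀ f {g g'} → g ≋ g' → (f ⊕ g) ≋ (f ⊕ g')
⊕-congˡ f = ⊕-cong {f = f} ≋-refl

scale-cong : ∀ c {f g} → f ≋ g → scaleS c f ≋ scaleS c g
scale-cong c f≋g n = cong (c *_) (f≋g n)

shift : Series → Series
shift f zero    = 0ℚ
shift f (suc n) = f n

shiftN : ℕ → Series → Series
shiftN zero    f = f
shiftN (suc a) f = shift (shiftN a f)

shift-cong : ∀ {f g} → f ≋ g → shift f ≋ shift g
shift-cong f≋g zero    = refl
shift-cong f≋g (suc n) = f≋g n

shift-⊕ : ∀ f g → shift (f ⊕ g) ≋ (shift f ⊕ shift g)
shift-⊕ f g zero    = sym (ℚ.+-identityʳ 0ℚ)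
shift-⊕ f g (suc n) = refl

shift-scale : ∀ c f → shift (scaleS c f) ≋ scaleS c (shift f)
shift-scale c f zero    = sym (ℚ.*-zeroʳ c)
shift-scale c f (suc n) = refl

shift-zero : shift zeroS ≋ zeroS
shift-zero zero    = refl
shift-zero (suc n) = refl

shiftN-cong : ∀ a {f g} → f ≋ g → shiftN a f ≋ shiftN a g
shiftN-cong zero    f≋g = f≋g
shiftN-cong (suc a) f≋g = shift-cong (shiftN-cong a f≋g)

shiftN-⊕ : ∀ a f g → shiftN a (f ⊕ g) ≋ (shiftN a f ⊕ shiftN a g)
shiftN-⊕ zero    f g = ≋-refl
shiftN-⊕ (suc a) f g = ≋-trans (shift-cong (shiftN-⊕ a f g)) (shift-⊕ _ _)

shiftN-scale : ∀ a c f → shiftN a (scaleS c f) ≋ scaleS c (shiftN a f)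
shiftN-scale zero    c f = ≋-refl
shiftN-scale (suc a) c f = ≋-trans (shift-cong (shiftN-scale a c f)) (shift-scale c _)

shiftN-zero : ∀ a → shiftN a zeroS ≋ zeroS
shiftN-zero zero    = ≋-refl
shiftN-zero (suc a) = ≋-trans (shift-cong (shiftN-zero a)) shift-zero

shiftN-shift : ∀ a f → shiftN a (shift f) ≋ shiftN (suc a) f
shiftN-shift zero    f = ≋-refl
shiftN-shift (suc a) f = shift-cong (shiftN-shift a f)

sumUpTo-cong : ∀ {h h'} → (∀ i → h i ≡ h' i) → ∀ n → sumUpTo h n ≡ sumUpTo h' n
sumUpTo-cong h≗h' zero    = h≗h' zero
sumUpTo-cong h≗h' (suc n) = cong₂ _+_ (sumUpTo-cong h≗h' n) (h≗h' (suc n))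

sumUpTo-+ : ∀ h h' n → sumUpTo (λ i → h i + h' i) n ≡ sumUpTo h n + sumUpTo h' n
sumUpTo-+ h h' zero    = refl
sumUpTo-+ h h' (suc n) =
  trans (cong (_+ (h (suc n) + h' (suc n))) (sumUpTo-+ h h' n))
        (interchange (sumUpTo h n) (sumUpTo h' n) (h (suc n)) (h' (suc n)))

sumUpTo-* : ∀ c h n → sumUpTo (λ i → c * h i) n ≡ c * sumUpTo h n
sumUpTo-* c h zero    = refl
sumUpTo-* c h (suc n) =
  trans (cong (_+ (c * h (suc n))) (sumUpTo-* c h n)) (sym (ℚ.*-distribˡ-+ c _ _))

sumUpTo-suc : ∀ h n → sumUpTo h (suc n) ≡ h zero + sumUpTo (h ∘ suc) n
sumUpTo-suc h zero    = refl
sumUpTo-suc h (suc n) =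
  trans (cong (_+ h (suc (suc n))) (sumUpTo-suc h n))
        (ℚ.+-assoc (h zero) (sumUpTo (h ∘ suc) n) (h (suc (suc n))))

⊛-congˡ : ∀ {f f'} g → f ≋ f' → (f ⊛ g) ≋ (f' ⊛ g)
⊛-congˡ g f≋f' n = sumUpTo-cong (λ i → cong (_* g (n ∸ i)) (f≋f' i)) n

⊛-congʳ : ∀ f {g g'} → g ≋ g' → (f ⊛ g) ≋ (f ⊛ g')
⊛-congʳ f g≋g' n = sumUpTo-cong (λ i → cong (f i *_) (g≋g' (n ∸ i))) n

⊛-distribʳ-⊕ : ∀ f f' g → ((f ⊕ f') ⊛ g) ≋ ((f ⊛ g) ⊕ (f' ⊛ g))
⊛-distribʳ-⊕ f f' g n =
  trans (sumUpTo-cong (λ i → ℚ.*-distribʳ-+ (g (n ∸ i)) (f i) (f' i)) n) (sumUpTo-+ _ _ n)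

⊛-distribˡ-⊕ : ∀ f g g' → (f ⊛ (g ⊕ g')) ≋ ((f ⊛ g) ⊕ (f ⊛ g'))
⊛-distribˡ-⊕ f g g' n =
  trans (sumUpTo-cong (λ i → ℚ.*-distribˡ-+ (f i) (g (n ∸ i)) (g' (n ∸ i))) n)
        (sumUpTo-+ _ _ n)

⊛-scaleˡ : ∀ c f g → (scaleS c f ⊛ g) ≋ scaleS c (f ⊛ g)
⊛-scaleˡ c f g n =
  trans (sumUpTo-cong (λ i → ℚ.*-assoc c (f i) (g (n ∸ i))) n) (sumUpTo-* c _ n)

⊛-scaleʳ : ∀ c f g → (f ⊛ scaleS c g) ≋ scaleS c (f ⊛ g)
⊛-scaleʳ c f g n = trans (sumUpTo-cong swap n) (sumUpTo-* c _ n)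
  where
  swap : ∀ i → f i * (c * g (n ∸ i)) ≡ c * (f i * g (n ∸ i))
  swap i = trans (sym (ℚ.*-assoc (f i) c _))
                 (trans (cong (_* g (n ∸ i)) (ℚ.*-comm (f i) c)) (ℚ.*-assoc c (f i) _))

⊛-zeroˡ : ∀ g → (zeroS ⊛ g) ≋ zeroS
⊛-zeroˡ g n =
  trans (sumUpTo-* 0ℚ (λ i → g (n ∸ i)) n) (ℚ.*-zeroˡ (sumUpTo (λ i → g (n ∸ i)) n))

polyS-∷-⊛ : ∀ a Q f → (polyS (a ∷ Q) ⊛ f) ≋ (scaleS a f ⊕ shift (polyS Q ⊛ f))
polyS-∷-⊛ a Q f zero    = sym (ℚ.+-identityʳ _)
polyS-∷-⊛ a Q f (suc n) = sumUpTo-suc _ n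

polyS-0∷-⊛ : ∀ Q f → (polyS (0ℚ ∷ Q) ⊛ f) ≋ shift (polyS Q ⊛ f)
polyS-0∷-⊛ Q f = ≋-trans (polyS-∷-⊛ 0ℚ Q f)
  (λ n → trans (cong (_+ shift (polyS Q ⊛ f) n) (ℚ.*-zeroˡ (f n))) (ℚ.+-identityˡ _))

monomial-⊛ : ∀ a f → (polyS (monomial a) ⊛ f) ≋ shiftN a f
monomial-⊛ zero f = begin
  polyS (1ℚ ∷ []) ⊛ f                 ≈⟨ polyS-∷-⊛ 1ℚ [] f ⟩
  scaleS 1ℚ f ⊕ shift (polyS [] ⊛ f)  ≈⟨ ⊕-cong (λ n → ℚ.*-identityˡ (f n))
                                           (≋-trans (shift-cong (⊛-zeroˡ f)) shift-zero) ⟩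
  f ⊕ zeroS                           ≈⟨ (λ n → ℚ.+-identityʳ (f n)) ⟩
  f                                   ∎
monomial-⊛ (suc a) f = ≋-trans (polyS-0∷-⊛ (monomial a) f) (shift-cong (monomial-⊛ a f))

geomS-⊛ : ∀ g → (geomS ⊛ g) ≋ (g ⊕ shift (geomS ⊛ g))
geomS-⊛ g zero    = trans (ℚ.*-identityˡ (g 0)) (sym (ℚ.+-identityʳ (g 0)))
geomS-⊛ g (suc n) =
  trans (sumUpTo-suc _ n) (cong (_+ (geomS ⊛ g) n) (ℚ.*-identityˡ (g (suc n))))

scaleTerms : ℚ → List (ℚ × I) → List (ℚ × I)
scaleTerms c = map (map₁ (c *_))

reindexTerms : (I → J) → List (ℚ × I) → List (ℚ × J)
reindexTerms r = map (map₂ r)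

_⊗_ : List (ℚ × I) → List (ℚ × J) → List (ℚ × (I × J))
cs ⊗ ds = concatMap (λ (c , i) → scaleTerms c (reindexTerms (i ,_) ds)) cs

linComb-++ : (e : I → Series) → ∀ cs ds →
  linComb e (cs ++ ds) ≋ (linComb e cs ⊕ linComb e ds)
linComb-++ e []             ds n = sym (ℚ.+-identityˡ _)
linComb-++ e ((c , i) ∷ cs) ds n =
  trans (cong (c * e i n +_) (linComb-++ e cs ds n)) (sym (ℚ.+-assoc (c * e i n) _ _))

linComb-scaleTerms : (e : I → Series) → ∀ c cs →
  linComb e (scaleTerms c cs) ≋ scaleS c (linComb e cs)
linComb-scaleTerms e c []             n = sym (ℚ.*-zeroʳ c)
linComb-scaleTerms e c ((d , i) ∷ cs) n =
  trans (cong₂ _+_ (ℚ.*-assoc c d (e i n)) (linComb-scaleTerms e c cs n))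
        (sym (ℚ.*-distribˡ-+ c _ _))

linComb-reindexTerms : (e : J → Series) (r : I → J) → ∀ cs →
  linComb e (reindexTerms r cs) ≋ linComb (e ∘ r) cs
linComb-reindexTerms e r []             n = refl
linComb-reindexTerms e r ((c , i) ∷ cs) n =
  cong (c * e (r i) n +_) (linComb-reindexTerms e r cs n)

linComb-cong : {e e' : I → Series} → (∀ i → e i ≋ e' i) →
  ∀ cs → linComb e cs ≋ linComb e' cs
linComb-cong e≋e' []             n = refl
linComb-cong e≋e' ((c , i) ∷ cs) n =
  cong₂ _+_ (cong (c *_) (e≋e' i n)) (linComb-cong e≋e' cs n)

linComb-⊗ : (K : I → J → Series) → ∀ cs ds →
  linComb (λ i → linComb (K i) ds) cs ≋ linComb (uncurry K) (cs ⊗ ds)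
linComb-⊗ K []             ds = ≋-refl
linComb-⊗ K ((c , i) ∷ cs) ds = ≋-sym (begin
  linComb (uncurry K) (row ++ (cs ⊗ ds))
    ≈⟨ linComb-++ (uncurry K) row (cs ⊗ ds) ⟩
  linComb (uncurry K) row ⊕ linComb (uncurry K) (cs ⊗ ds)
    ≈⟨ ⊕-cong (≋-trans (linComb-scaleTerms (uncurry K) c (reindexTerms (i ,_) ds))
                       (scale-cong c (linComb-reindexTerms (uncurry K) (i ,_) ds)))
              (≋-sym (linComb-⊗ K cs ds)) ⟩
  scaleS c (linComb (K i) ds) ⊕ linComb (λ i → linComb (K i) ds) cs ∎)
  where row = scaleTerms c (reindexTerms (i ,_) ds)

linComb-coefficient : {e e' : I → Series} (N : ℕ) → (∀ i → e i N ≡ e' i N) →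
  ∀ cs → linComb e cs N ≡ linComb e' cs N
linComb-coefficient N eN≡e'N []             = refl
linComb-coefficient N eN≡e'N ((c , i) ∷ cs) =
  cong₂ _+_ (cong (c *_) (eN≡e'N i)) (linComb-coefficient N eN≡e'N cs)

module _ {P : I → Set} {e : I → Series} where

  InSpan-resp : ∀ {f g} → f ≋ g → InSpan P e f → InSpan P e g
  InSpan-resp f≋g (cs , P-cs , f≋cs) = cs , P-cs , ≋-trans (≋-sym f≋g) f≋cs

  InSpan-zero : InSpan P e zeroS
  InSpan-zero = [] , [] , ≋-refl

  InSpan-generator : ∀ {i} → P i → InSpan P e (e i)
  InSpan-generator {i} Pi =
    (1ℚ , i) ∷ [] , Pi ∷ [] , λ n → sym (trans (ℚ.+-identityʳ _) (ℚ.*-identityˡ (e i n)))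

  InSpan-⊕ : ∀ {f g} → InSpan P e f → InSpan P e g → InSpan P e (f ⊕ g)
  InSpan-⊕ (cs , P-cs , f≋cs) (ds , P-ds , g≋ds) =
    cs ++ ds , ++⁺ P-cs P-ds , ≋-trans (⊕-cong f≋cs g≋ds) (≋-sym (linComb-++ e cs ds))

  InSpan-scale : ∀ c {f} → InSpan P e f → InSpan P e (scaleS c f)
  InSpan-scale c (cs , P-cs , f≋cs) =
    scaleTerms c cs , map⁺ P-cs ,
    ≋-trans (scale-cong c f≋cs) (≋-sym (linComb-scaleTerms e c cs))

InSpan-reindex : {P : I → Set} {Q : J → Set} {e : J → Series} (r : I → J) →
  (∀ {i} → P i → Q (r i)) → ∀ {f} → InSpan P (e ∘ r) f → InSpan Q e f
InSpan-reindex {e = e} r P⇒Q (cs , P-cs , f≋cs) =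
  reindexTerms r cs , map⁺ (All.map P⇒Q P-cs) ,
  ≋-trans f≋cs (≋-sym (linComb-reindexTerms e r cs))

InSpan-bind : {P : I → Set} {Q : J → Set} {e : I → Series} {e' : J → Series} →
  (∀ {i} → P i → InSpan Q e' (e i)) → ∀ {f} → InSpan P e f → InSpan Q e' f
InSpan-bind {P = P} {Q} {e} {e'} e∈span (cs , P-cs , f≋cs) =
  InSpan-resp (≋-sym f≋cs) (linComb-inSpan cs P-cs)
  where
  linComb-inSpan : ∀ cs → All (λ ci → P (proj₂ ci)) cs → InSpan Q e' (linComb e cs)
  linComb-inSpan []             []           = InSpan-zero
  linComb-inSpan ((c , i) ∷ cs) (Pi ∷ P-cs) =
    InSpan-⊕ (InSpan-scale c (e∈span Pi)) (linComb-inSpan cs P-cs)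

bzKernel : ℕ → Series
bzKernel j = polyS (monomial (j ∸ 1)) ⊛ invPow j

monomialFraction-inSpan : ∀ a d → InSpan (a <_) bzKernel (shiftN a (invPow (a ℕ.+ suc d)))
monomialFraction-inSpan a zero rewrite +-comm a 1 =
  InSpan-resp (monomial-⊛ a (invPow (suc a))) (InSpan-generator ≤-refl)
monomialFraction-inSpan a (suc d) rewrite +-suc a (suc d) =
  InSpan-resp (≋-sym split)
    (InSpan-⊕ (monomialFraction-inSpan a d)
              (InSpan-reindex id <⇒≤ (monomialFraction-inSpan (suc a) d)))
  where
  k = a ℕ.+ suc d
  split : shiftN a (invPow (suc k)) ≋ (shiftN a (invPow k) ⊕ shiftN (suc a) (invPow (suc k)))
  split = begin
    shiftN a (invPow (suc k))                            ≈⟨ shiftN-cong a (geomS-⊛ (invPow k)) ⟩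
    shiftN a (invPow k ⊕ shift (invPow (suc k)))         ≈⟨ shiftN-⊕ a _ _ ⟩
    shiftN a (invPow k) ⊕ shiftN a (shift (invPow (suc k)))
      ≈⟨ ⊕-congˡ (shiftN a (invPow k)) (shiftN-shift a (invPow (suc k))) ⟩
    shiftN a (invPow k) ⊕ shiftN (suc a) (invPow (suc k)) ∎

polyFraction-inSpan : ∀ a k Q → length Q ≤ k →
  InSpan (a <_) bzKernel (shiftN a (polyS Q ⊛ invPow (a ℕ.+ k)))
polyFraction-inSpan a k [] _ =
  InSpan-resp (≋-sym (≋-trans (shiftN-cong a (⊛-zeroˡ (invPow (a ℕ.+ k)))) (shiftN-zero a)))
    InSpan-zero
polyFraction-inSpan a (suc k) (q ∷ Q) (s≤s |Q|≤k) =
  InSpan-resp (≋-sym split)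
    (InSpan-⊕ (InSpan-scale q (monomialFraction-inSpan a k))
              (InSpan-reindex id <⇒≤ (polyFraction-inSpan (suc a) k Q |Q|≤k)))
  where
  F = invPow (a ℕ.+ suc k)
  split : shiftN a (polyS (q ∷ Q) ⊛ F) ≋
          (scaleS q (shiftN a F) ⊕ shiftN (suc a) (polyS Q ⊛ invPow (suc a ℕ.+ k)))
  split = begin
    shiftN a (polyS (q ∷ Q) ⊛ F)                       ≈⟨ shiftN-cong a (polyS-∷-⊛ q Q F) ⟩
    shiftN a (scaleS q F ⊕ shift (polyS Q ⊛ F))        ≈⟨ shiftN-⊕ a _ _ ⟩
    shiftN a (scaleS q F) ⊕ shiftN a (shift (polyS Q ⊛ F))
      ≈⟨ ⊕-cong (shiftN-scale a q F) (shiftN-shift a (polyS Q ⊛ F)) ⟩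
    scaleS q (shiftN a F) ⊕ shiftN (suc a) (polyS Q ⊛ F)
      ≈⟨ ⊕-congˡ (scaleS q (shiftN a F)) (shiftN-cong (suc a)
                   (⊛-congʳ (polyS Q) (≋-reflexive (cong invPow (+-suc a k))))) ⟩
    scaleS q (shiftN a F) ⊕ shiftN (suc a) (polyS Q ⊛ invPow (suc a ℕ.+ k)) ∎

fraction-inSpan : ∀ {k Q} → length Q ≤ k → InSpan (1 ≤_) bzKernel (polyS Q ⊛ invPow k)
fraction-inSpan {k} {Q} = polyFraction-inSpan 0 k Q

fraction-inSpan-noConstTerm : ∀ {k Q} → length Q ≤ k → constTerm Q ≡ 0ℚ →
  InSpan (2 ≤_) bzKernel (polyS Q ⊛ invPow k)
fraction-inSpan-noConstTerm {k} {[]} _ _ = InSpan-resp (≋-sym (⊛-zeroˡ (invPow k))) InSpan-zero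
fraction-inSpan-noConstTerm {suc k} {.0ℚ ∷ Q} (s≤s |Q|≤k) refl =
  InSpan-resp (≋-sym (polyS-0∷-⊛ Q (invPow (suc k)))) (polyFraction-inSpan 1 k Q |Q|≤k)

Family : Set → Set
Family A = A → Series

record Linear {A B : Set} (Φ : Family A → Family B) : Set where
  field
    ≋-cong    : ∀ {F G} → (∀ a → F a ≋ G a) → ∀ b → Φ F b ≋ Φ G b
    ⊕-hom     : ∀ F G b → Φ (λ a → F a ⊕ G a) b ≋ (Φ F b ⊕ Φ G b)
    scale-hom : ∀ c F b → Φ (λ a → scaleS c (F a)) b ≋ scaleS c (Φ F b)

  zero-hom : ∀ b → Φ (λ _ → zeroS) b ≋ zeroS
  zero-hom b = begin
    Φ (λ _ → zeroS) b              ≈⟨ ≋-cong (λ _ n → sym (ℚ.*-zeroˡ 0ℚ)) b ⟩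
    Φ (λ _ → scaleS 0ℚ zeroS) b    ≈⟨ scale-hom 0ℚ (λ _ → zeroS) b ⟩
    scaleS 0ℚ (Φ (λ _ → zeroS) b)  ≈⟨ (λ n → ℚ.*-zeroˡ (Φ (λ _ → zeroS) b n)) ⟩
    zeroS                          ∎

  linComb-hom : (G : I → Family A) → ∀ cs b →
    Φ (λ a → linComb (λ i → G i a) cs) b ≋ linComb (λ i → Φ (G i) b) cs
  linComb-hom G []             b = zero-hom b
  linComb-hom G ((c , i) ∷ cs) b = begin
    Φ (λ a → scaleS c (G i a) ⊕ linComb (λ i → G i a) cs) b
      ≈⟨ ⊕-hom (λ a → scaleS c (G i a)) (λ a → linComb (λ i → G i a) cs) b ⟩
    Φ (λ a → scaleS c (G i a)) b ⊕ Φ (λ a → linComb (λ i → G i a) cs) b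
      ≈⟨ ⊕-cong (scale-hom c (G i) b) (linComb-hom G cs b) ⟩
    scaleS c (Φ (G i) b) ⊕ linComb (λ i → Φ (G i) b) cs ∎

open Linear

reindex-linear : (r : B → A) → Linear {A} {B} (_∘ r)
reindex-linear r = record
  { ≋-cong    = λ F≋G b → F≋G (r b)
  ; ⊕-hom     = λ _ _ _ → ≋-refl
  ; scale-hom = λ _ _ _ → ≋-refl
  }

∘-linear : {Φ : Family B → Family C} {Ψ : Family A → Family B} →
  Linear Φ → Linear Ψ → Linear (Φ ∘ Ψ)
∘-linear {Φ = Φ} {Ψ} Φ-lin Ψ-lin = record
  { ≋-cong    = λ F≋G → ≋-cong Φ-lin (≋-cong Ψ-lin F≋G)
  ; ⊕-hom     = λ F G b →
      ≋-trans (≋-cong Φ-lin (⊕-hom Ψ-lin F G) b) (⊕-hom Φ-lin (Ψ F) (Ψ G) b)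
  ; scale-hom = λ c F b →
      ≋-trans (≋-cong Φ-lin (scale-hom Ψ-lin c F) b) (scale-hom Φ-lin c (Ψ F) b)
  }

sumBelow-linear : Linear sumBelow
sumBelow-linear = record { ≋-cong = cong′ ; ⊕-hom = ⊕-hom′ ; scale-hom = scale-hom′ }
  where
  cong′ : ∀ {F G : Family ℕ} → (∀ i → F i ≋ G i) → ∀ n → sumBelow F n ≋ sumBelow G n
  cong′ F≋G zero    = ≋-refl
  cong′ F≋G (suc n) = ⊕-cong (cong′ F≋G n) (F≋G n)

  ⊕-hom′ : ∀ F G n → sumBelow (λ i → F i ⊕ G i) n ≋ (sumBelow F n ⊕ sumBelow G n)
  ⊕-hom′ F G zero    k = sym (ℚ.+-identityʳ 0ℚ)
  ⊕-hom′ F G (suc n) k =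
    trans (cong (_+ (F n k + G n k)) (⊕-hom′ F G n k))
          (interchange (sumBelow F n k) (sumBelow G n k) (F n k) (G n k))

  scale-hom′ : ∀ c F n → sumBelow (λ i → scaleS c (F i)) n ≋ scaleS c (sumBelow F n)
  scale-hom′ c F zero    k = sym (ℚ.*-zeroʳ c)
  scale-hom′ c F (suc n) k =
    trans (cong (_+ (c * F n k)) (scale-hom′ c F n k)) (sym (ℚ.*-distribˡ-+ c _ _))

⊛ˡ-linear : (G : Family A) → Linear (λ F a → F a ⊛ G a)
⊛ˡ-linear G = record
  { ≋-cong    = λ F≋F' a → ⊛-congˡ (G a) (F≋F' a)
  ; ⊕-hom     = λ F F' a → ⊛-distribʳ-⊕ (F a) (F' a) (G a)
  ; scale-hom = λ c F a → ⊛-scaleˡ c (F a) (G a)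
  }

⊛ʳ-linear : (F : Family A) → Linear (λ G a → F a ⊛ G a)
⊛ʳ-linear F = record
  { ≋-cong    = λ G≋G' a → ⊛-congʳ (F a) (G≋G' a)
  ; ⊕-hom     = λ G G' a → ⊛-distribˡ-⊕ (F a) (G a) (G' a)
  ; scale-hom = λ c G a → ⊛-scaleʳ c (F a) (G a)
  }

substPow-linear : Linear (λ F m → substPow m (F m))
substPow-linear = record { ≋-cong = cong′ ; ⊕-hom = ⊕-hom′ ; scale-hom = scale-hom′ }
  where
  cong′ : ∀ {F G : Family ℕ} → (∀ m → F m ≋ G m) → ∀ m → substPow m (F m) ≋ substPow m (G m)
  cong′ F≋G m N with N % suc m ℕ.≟ 0
  ... | yes _ = F≋G m (N / suc m)
  ... | no  _ = refl

  ⊕-hom′ : ∀ (F G : Family ℕ) m → substPow m (F m ⊕ G m) ≋ (substPow m (F m) ⊕ substPow m (G m))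
  ⊕-hom′ F G m N with N % suc m ℕ.≟ 0
  ... | yes _ = refl
  ... | no  _ = sym (ℚ.+-identityʳ 0ℚ)

  scale-hom′ : ∀ c (F : Family ℕ) m → substPow m (scaleS c (F m)) ≋ scaleS c (substPow m (F m))
  scale-hom′ c F m N with N % suc m ℕ.≟ 0
  ... | yes _ = refl
  ... | no  _ = sym (ℚ.*-zeroʳ c)

-- The same linear combination for every member of the family; this uniformity is what lets
-- the outer sum of truncZ, which evaluates its tail at varying bounds, be expanded termwise.
Decomposes : {A I : Set} → (I → Set) → (I → Family A) → Family A → Set
Decomposes {I = I} P G F =
  Σ (List (ℚ × I)) λ cs →
    All (λ ci → P (proj₂ ci)) cs × (∀ a → F a ≋ linComb (λ i → G i a) cs)

module _ {P : I → Set} where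

  Decomposes-constant : {e : I → Series} {f : Series} →
    InSpan P e f → Decomposes {A} P (λ i _ → e i) (λ _ → f)
  Decomposes-constant (cs , P-cs , f≋cs) = cs , P-cs , λ _ → f≋cs

  Decomposes-generator : {G : I → Family A} → ∀ {i} → P i → Decomposes P G (G i)
  Decomposes-generator {G = G} {i} Pi =
    (1ℚ , i) ∷ [] , Pi ∷ [] , λ a n → sym (trans (ℚ.+-identityʳ _) (ℚ.*-identityˡ (G i a n)))

  Decomposes-reindex : {Q : J → Set} {G : J → Family A} {F : Family A} (r : I → J) →
    (∀ {i} → P i → Q (r i)) → Decomposes P (G ∘ r) F → Decomposes Q G F
  Decomposes-reindex {G = G} r P⇒Q (cs , P-cs , F≋cs) =
    reindexTerms r cs , map⁺ (All.map P⇒Q P-cs) ,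
    λ a → ≋-trans (F≋cs a) (≋-sym (linComb-reindexTerms (λ j → G j a) r cs))

  Decomposes-linear : {G : I → Family A} {F : Family A} {Φ : Family A → Family B} →
    Linear Φ → Decomposes P G F → Decomposes P (Φ ∘ G) (Φ F)
  Decomposes-linear {G = G} Φ-lin (cs , P-cs , F≋cs) =
    cs , P-cs , λ b → ≋-trans (≋-cong Φ-lin F≋cs b) (linComb-hom Φ-lin G cs b)

  Decomposes-diagonal : {G : I → Family ℕ} {F : Family ℕ} →
    Decomposes P G F → InSpan P (λ i N → G i (suc N) N) (λ N → F (suc N) N)
  Decomposes-diagonal (cs , P-cs , F≋cs) =
    cs , P-cs , λ N → trans (F≋cs (suc N) N) (linComb-coefficient N (λ _ → refl) cs)

All-⊗ : {P : I → Set} {Q : J → Set} → ∀ {cs ds} →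
  All (λ ci → P (proj₂ ci)) cs → All (λ dj → Q (proj₂ dj)) ds →
  All (λ x → P (proj₁ (proj₂ x)) × Q (proj₂ (proj₂ x))) (cs ⊗ ds)
All-⊗ []          Q-ds = []
All-⊗ (Pi ∷ P-cs) Q-ds = ++⁺ (map⁺ (map⁺ (All.map (Pi ,_) Q-ds))) (All-⊗ P-cs Q-ds)

Decomposes-bilinear : {P : I → Set} {Q : J → Set} {G : I → Family A} {H : J → Family B}
  {F : Family A} {F' : Family B} (Φ : Family A → Family B → Family C) →
  (∀ F' → Linear (λ F → Φ F F')) → (∀ F → Linear (Φ F)) →
  Decomposes P G F → Decomposes Q H F' →
  Decomposes (λ p → P (proj₁ p) × Q (proj₂ p)) (λ p → Φ (G (proj₁ p)) (H (proj₂ p))) (Φ F F')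
Decomposes-bilinear {G = G} {H} {F} {F'} Φ linearˡ linearʳ
                    (cs , P-cs , F≋cs) (ds , Q-ds , F'≋ds) =
  cs ⊗ ds , All-⊗ P-cs Q-ds , λ c → begin
    Φ F F' c
      ≈⟨ ≋-cong (linearˡ F') F≋cs c ⟩
    Φ (λ a → linComb (λ i → G i a) cs) F' c
      ≈⟨ linComb-hom (linearˡ F') G cs c ⟩
    linComb (λ i → Φ (G i) F' c) cs
      ≈⟨ linComb-cong (λ i → ≋-trans (≋-cong (linearʳ (G i)) F'≋ds c)
                                     (linComb-hom (linearʳ (G i)) H ds c)) cs ⟩
    linComb (λ i → linComb (λ j → Φ (G i) (H j) c) ds) cs
      ≈⟨ linComb-⊗ (λ i j → Φ (G i) (H j) c) cs ds ⟩
    linComb (λ p → Φ (G (proj₁ p)) (H (proj₂ p)) c) (cs ⊗ ds) ∎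

-- truncZ ((k , Q) ∷ ks) is definitionally outerSum (termS k Q) (truncZ ks).
outerSum : Family ℕ → Family ℕ → Family ℕ
outerSum T F M = sumBelow (λ i → T i ⊛ F (suc i)) (M ∸ 1)

outerSum-linearˡ : ∀ F → Linear (λ T → outerSum T F)
outerSum-linearˡ F =
  ∘-linear (reindex-linear (_∸ 1)) (∘-linear sumBelow-linear (⊛ˡ-linear (F ∘ suc)))

outerSum-linearʳ : ∀ T → Linear (outerSum T)
outerSum-linearʳ T =
  ∘-linear (reindex-linear (_∸ 1))
    (∘-linear sumBelow-linear (∘-linear (⊛ʳ-linear T) (reindex-linear suc)))

bzTerm : ℕ → Family ℕ
bzTerm j = termS j (monomial (j ∸ 1))

bzTrunc : List ℕ → Family ℕ
bzTrunc ks = truncZ (bzData ks)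

termS-decomposes : ∀ {P k Q} → InSpan P bzKernel (polyS Q ⊛ invPow k) →
  Decomposes P bzTerm (termS k Q)
termS-decomposes h = Decomposes-linear substPow-linear (Decomposes-constant h)

truncZ-∷-decomposes : ∀ {P : ℕ → Set} {R P' : List ℕ → Set} {k Q ks} →
  (∀ {j b} → P j → R b → P' (j ∷ b)) →
  InSpan P bzKernel (polyS Q ⊛ invPow k) → Decomposes R bzTrunc (truncZ ks) →
  Decomposes P' bzTrunc (truncZ ((k , Q) ∷ ks))
truncZ-∷-decomposes {k = k} {Q} P∷R h tail =
  Decomposes-reindex (uncurry _∷_) (uncurry P∷R)
    (Decomposes-bilinear outerSum outerSum-linearˡ outerSum-linearʳ
      (termS-decomposes {k = k} {Q} h) tail)

truncZ-decomposes-admissible : ∀ {ks} → All AdmEntry ks →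
  Decomposes (All (1 ≤_)) bzTrunc (truncZ ks)
truncZ-decomposes-admissible [] = Decomposes-generator {i = []} []
truncZ-decomposes-admissible {(k , Q) ∷ ks} ((_ , |Q|≤k) ∷ adms) =
  truncZ-∷-decomposes {k = k} {Q} {ks} _∷_
    (fraction-inSpan {k} {Q} |Q|≤k) (truncZ-decomposes-admissible adms)

truncZ-decomposes : ∀ {ks} → AdmZ1 ks → Decomposes AdmBZ bzTrunc (truncZ ks)
truncZ-decomposes {[]} _ = Decomposes-generator {i = []} tt
truncZ-decomposes {(k , Q) ∷ ks} ((_ , |Q|≤k) ∷ adms , Q₀≡0) =
  truncZ-∷-decomposes {k = k} {Q} {ks} _,_
    (fraction-inSpan-noConstTerm {k} {Q} |Q|≤k Q₀≡0) (truncZ-decomposes-admissible adms)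

length-monomial-≤ : ∀ n → length (monomial n) ≤ suc n
length-monomial-≤ zero    = s≤s z≤n
length-monomial-≤ (suc n) = s≤s (length-monomial-≤ n)

bzData-admissible : ∀ {ks} → All (1 ≤_) ks → All AdmEntry (bzData ks)
bzData-admissible []                       = []
bzData-admissible {suc k ∷ _} (1≤k ∷ ks) = (1≤k , length-monomial-≤ k) ∷ bzData-admissible ks

bzData-AdmZ1 : ∀ {ks} → AdmBZ ks → AdmZ1 (bzData ks)
bzData-AdmZ1 {[]}    _                        = [] , tt
bzData-AdmZ1 {k ∷ _} (2≤k@(s≤s (s≤s _)) , ks) =
  (<⇒≤ 2≤k , length-monomial-≤ (k ∸ 1)) ∷ bzData-admissible ks , refl

zetaQ-inBZSpan : ∀ {ks} → AdmZ1 ks → InSpan AdmBZ zetaBZ (zetaQ ks)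
zetaQ-inBZSpan adm = Decomposes-diagonal (truncZ-decomposes adm)

proposition2p25 : (f : Series) → (InZq1 f → InBZSpan f) × (InBZSpan f → InZq1 f)
proposition2p25 f = InSpan-bind zetaQ-inBZSpan , InSpan-reindex bzData bzData-AdmZ1
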